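{- Let $n\ge3$ be a deficient number, i.e. $\sigma(n)<2n$ where $\sigma(n)$ is the sum of the positive divisors of $n$. Then $\Gamma_N(D_n)$ is not Hamiltonian, where $D_n=\langle a,b\mid a^n=b^2=1,\ ab=ba^{ -1}\rangle$.
   Context: $\Gamma_N(G)$ denotes the simple graph whose vertices are the proper non-normal subgroups of the group $G$, two distinct vertices $H,K$ being adjacent iff $HK=KH$. A graph is Hamiltonian if it has a cycle through all its vertices. -}

module Defs where

open import Data.Nat using (ℕ; zero; suc; _+_; _*_; _<_; _≥_; NonZero)
open import Data.Nat.DivMod using (_mod_)
open import Data.Nat.Divisibility using (_∣?_)
open import Data.Fin using (Fin; toℕ)
open import Data.Bool using (Bool; true; false)
open import Data.Product using (_×_; _,_; Σ; ∃)
open import Data.List using (List; []; _∷_; filter; applyUpTo)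
open import Data.Nat.ListAction using (sum)
open import Data.Empty using (⊥)
open import Relation.Nullary using (¬_)
open import Relation.Binary.PropositionalEquality using (_≡_; _≢_)

σ : ℕ → ℕ
σ n = sum (filter (_∣? n) (applyUpTo suc n))

Deficient : ℕ → Set
Deficient n = σ n < 2 * n

-- The dihedral group D_n = ⟨a,b | a^n = b^2 = 1, ab = ba⁻¹⟩ of order 2n.
-- Element (false , i) is a^i, element (true , i) is a^i b.

D : ℕ → Set
D n = Bool × Fin n

module _ (n : ℕ) .{{_ : NonZero n}} where

  -- i - j mod n, computed as i + (n - j) mod n
  private
    add : Fin n → Fin n → Fin n
    add i j = (toℕ i + toℕ j) mod n
    sub : Fin n → Fin n → Fin n
    sub i j = (toℕ i + (n Data.Nat.∸ toℕ j)) mod n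

  -- a^i a^j = a^(i+j);  a^i (a^j b) = a^(i+j) b;
  -- (a^i b) a^j = a^(i-j) b;  (a^i b)(a^j b) = a^(i-j)
  mul : D n → D n → D n
  mul (false , i) (false , j) = false , add i j
  mul (false , i) (true  , j) = true  , add i j
  mul (true  , i) (false , j) = true  , sub i j
  mul (true  , i) (true  , j) = false , sub i j

  one : D n
  one = false , 0 mod n

  -- (a^i)⁻¹ = a^(-i);  (a^i b)⁻¹ = a^i b
  inv : D n → D n
  inv (false , i) = false , sub (0 mod n) i
  inv (true  , i) = true , i

  Subset : Set
  Subset = D n → Bool

  _∈_ : D n → Subset → Set
  x ∈ H = H x ≡ true

  record IsSubgroup (H : Subset) : Set where
    field
      one-mem : one ∈ H
      mul-mem : ∀ x y → x ∈ H → y ∈ H → mul x y ∈ H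
      inv-mem : ∀ x → x ∈ H → inv x ∈ H

  Proper : Subset → Set
  Proper H = ∃ λ x → ¬ (x ∈ H)

  Normal : Subset → Set
  Normal H = ∀ g h → h ∈ H → mul (mul g h) (inv g) ∈ H

  IsVertex : Subset → Set
  IsVertex H = IsSubgroup H × Proper H × ¬ Normal H

  InProd : Subset → Subset → D n → Set
  InProd H K x = Σ (D n) λ h → Σ (D n) λ k → h ∈ H × k ∈ K × x ≡ mul h k

  Permute : Subset → Subset → Set
  Permute H K = (∀ x → InProd H K x → InProd K H x)
              × (∀ x → InProd K H x → InProd H K x)

  SameSet : Subset → Subset → Set
  SameSet H K = ∀ x → H x ≡ K x

  -- A Hamiltonian cycle of Γ_N(D_n): a cyclic sequence v₀,…,v_{k-1}
  -- (k = 3 + len ≥ 3) of pairwise distinct vertices, containing every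
  -- vertex, with v_i adjacent to v_{i+1 mod k}.
  record HamiltonianCycle : Set where
    field
      len      : ℕ
      cyc      : Fin (3 + len) → Subset
      vertices : ∀ i → IsVertex (cyc i)
      distinct : ∀ i j → i ≢ j → ¬ SameSet (cyc i) (cyc j)
      covers   : ∀ H → IsVertex H → ∃ λ i → SameSet H (cyc i)
      adjacent : ∀ i → Permute (cyc i) (cyc (suc (toℕ i) mod (3 + len)))

  Hamiltonian : Set
  Hamiltonian = HamiltonianCycle

module Submission where

-- A vertex H of Γ_N(D n) contains a reflection a^i b; its rotations are the
-- powers of a^d for a divisor d ∣ n (its index), its reflections are the a^j b
-- with j ≡ i (mod d), and H is determined by the pair (d , i mod d).  If M divides
-- the indices of H ∋ a^i b and K ∋ a^j b and 2i ≢ 2j (mod M), then HK ≠ KH.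
-- Write n = 2^a r with r odd and take M = r (M = 4 if r = 1).  Along a
-- Hamiltonian cycle, consecutive vertices with M ∣ d keep i mod r (resp. mod 2),
-- while the vertices {1 , a^c b} have d = n and realise every residue.  For r = 1
-- this is already contradictory; for r ≥ 3 each residue is left through a
-- distinct vertex with r ∤ d, and these r pairs (d , i mod d) together with the
-- pairs (r 2^k , i) give 2n distinct pairs with d ∣ n and i < d: σ(n) ≥ 2n.

module Congruence where

  open import Data.Nat
  open import Data.Nat.Properties
  open import Data.Nat.DivMod
  open import Data.Nat.Divisibility
  open import Data.Fin using (Fin; toℕ)
  open import Data.Fin.Properties using (toℕ-injective; toℕ<n; toℕ-fromℕ<)
  open import Relation.Binary.PropositionalEquality
  open import Relation.Binary.Bundles using (Setoid)
  import Relation.Binary.Construct.On as On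
  import Relation.Binary.Reasoning.Setoid as SetoidReasoning

  module Mod (M : ℕ) .{{_ : NonZero M}} where

    infix 4 _≋_
    _≋_ : ℕ → ℕ → Set
    a ≋ b = a % M ≡ b % M

    ≋-refl : ∀ {a} → a ≋ a
    ≋-refl = refl

    ≋-sym : ∀ {a b} → a ≋ b → b ≋ a
    ≋-sym = sym

    ≋-trans : ∀ {a b c} → a ≋ b → b ≋ c → a ≋ c
    ≋-trans = trans

    ≡⇒≋ : ∀ {a b} → a ≡ b → a ≋ b
    ≡⇒≋ refl = refl

    ≋-setoid : Setoid _ _
    ≋-setoid = On.setoid (setoid ℕ) (_% M)

    module ≋-Reasoning = SetoidReasoning ≋-setoid

    +-≋ : ∀ {a b c d} → a ≋ b → c ≋ d → a + c ≋ b + d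
    +-≋ {a} {b} {c} {d} p q = begin
      (a + c) % M          ≡⟨ %-distribˡ-+ a c M ⟩
      (a % M + c % M) % M  ≡⟨ cong₂ (λ x y → (x + y) % M) p q ⟩
      (b % M + d % M) % M  ≡⟨ %-distribˡ-+ b d M ⟨
      (b + d) % M          ∎
      where open ≡-Reasoning

    *-≋ : ∀ k {a b} → a ≋ b → k * a ≋ k * b
    *-≋ k {a} {b} p = begin
      (k * a) % M            ≡⟨ %-distribˡ-* k a M ⟩
      (k % M * (a % M)) % M  ≡⟨ cong (λ z → (k % M * z) % M) p ⟩
      (k % M * (b % M)) % M  ≡⟨ %-distribˡ-* k b M ⟨
      (k * b) % M            ∎
      where open ≡-Reasoning

    0%M : 0 % M ≡ 0
    0%M = m<n⇒m%n≡m (>-nonZero⁻¹ M)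

    %-≋ : ∀ a → a % M ≋ a
    %-≋ a = m%n%n≡m%n a M

    M≋0 : M ≋ 0
    M≋0 = trans (n%n≡0 M) (sym 0%M)

    +M-≋ : ∀ a → a + M ≋ a
    +M-≋ a = [m+n]%n≡m%n a M

    +kM-≋ : ∀ a k → a + k * M ≋ a
    +kM-≋ a k = [m+kn]%n≡m%n a k M

    ∣⇒≋0 : ∀ {a} → M ∣ a → a ≋ 0
    ∣⇒≋0 {a} p = trans (n∣m⇒m%n≡0 a M p) (sym 0%M)

    ≋0⇒∣ : ∀ {a} → a ≋ 0 → M ∣ a
    ≋0⇒∣ {a} p = m%n≡0⇒n∣m a M (trans p 0%M)

    +-inverse : ∀ a c → a + c + (M ∸ c % M) ≋ a
    +-inverse a c = begin
      (a + c + (M ∸ c % M)) % M      ≡⟨ +-≋ {a + c} (+-≋ {a} ≋-refl (≋-sym (%-≋ c))) ≋-refl ⟩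
      (a + c % M + (M ∸ c % M)) % M  ≡⟨ cong (_% M) (+-assoc a (c % M) _) ⟩
      (a + (c % M + (M ∸ c % M))) % M ≡⟨ cong (λ y → (a + y) % M) (m+[n∸m]≡n (m%n≤n c M)) ⟩
      (a + M) % M                    ≡⟨ +M-≋ a ⟩
      a % M                          ∎
      where open ≡-Reasoning

    cancelʳ : ∀ {a b c} → a + c ≋ b + c → a ≋ b
    cancelʳ {a} {b} {c} p = ≋-trans (≋-sym (+-inverse a c))
      (≋-trans (+-≋ {a + c} {b + c} p (≋-refl {M ∸ c % M})) (+-inverse b c))

    cancelˡ : ∀ {a b c} → c + a ≋ c + b → a ≋ b
    cancelˡ {a} {b} {c} p = cancelʳ {a} {b} {c}
      (≋-trans (≡⇒≋ (+-comm a c)) (≋-trans p (≡⇒≋ (+-comm c b))))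

  weaken : ∀ {M K} .{{_ : NonZero M}} .{{_ : NonZero K}} → K ∣ M →
           ∀ {a b} → Mod._≋_ M a b → Mod._≋_ K a b
  weaken {M} {K} K∣M {a} {b} p = begin
    a % K      ≡⟨ m∣n⇒o%n%m≡o%m K M a K∣M ⟨
    a % M % K  ≡⟨ cong (_% K) p ⟩
    b % M % K  ≡⟨ m∣n⇒o%n%m≡o%m K M b K∣M ⟩
    b % K      ∎
    where open ≡-Reasoning

  module FinMod (M : ℕ) .{{_ : NonZero M}} where
    open Mod M

    toℕ-mod : ∀ a → toℕ (a mod M) ≡ a % M
    toℕ-mod a = toℕ-fromℕ< (m%n<n a M)

    mod-≋ : ∀ a → toℕ (a mod M) ≋ a
    mod-≋ a = trans (cong (_% M) (toℕ-mod a)) (%-≋ a)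

    fin-≋ : ∀ (x y : Fin M) → toℕ x ≋ toℕ y → x ≡ y
    fin-≋ x y p = toℕ-injective (begin
      toℕ x      ≡⟨ m<n⇒m%n≡m (toℕ<n x) ⟨
      toℕ x % M  ≡⟨ p ⟩
      toℕ y % M  ≡⟨ m<n⇒m%n≡m (toℕ<n y) ⟩
      toℕ y      ∎)
      where open ≡-Reasoning

    mod-cong : ∀ {a b} → a ≋ b → a mod M ≡ b mod M
    mod-cong {a} {b} p = fin-≋ _ _ (≋-trans (mod-≋ a) (≋-trans p (≋-sym (mod-≋ b))))

    toℕ-mod-id : ∀ (x : Fin M) → toℕ x mod M ≡ x
    toℕ-mod-id x = fin-≋ _ _ (mod-≋ (toℕ x))

    ≋0⇒toℕ≡0 : ∀ (x : Fin M) → toℕ x ≋ 0 → toℕ x ≡ 0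
    ≋0⇒toℕ≡0 x p = trans (sym (m<n⇒m%n≡m (toℕ<n x))) (trans p 0%M)

module NumberTheory where

  open import Data.Nat
  open import Data.Nat.Properties
  open import Data.Nat.DivMod
  open import Data.Nat.Divisibility
  open import Data.Nat.Induction using (<-wellFounded)
  open import Induction.WellFounded using (Acc; acc)
  open import Data.Product using (∃; _,_)
  open import Data.Sum using (_⊎_; inj₁; inj₂)
  open import Relation.Binary.PropositionalEquality
  open import Data.Nat.Solver using (module +-*-Solver)
  open +-*-Solver using (solve; _:+_; _:*_; _:=_; con)
  open Congruence

  even-or-odd : ∀ d → (∃ λ e → d ≡ 2 * e) ⊎ d % 2 ≡ 1
  even-or-odd d with d % 2 | m≡m%n+[m/n]*n d 2 | m%n<n d 2
  ... | 0           | d≡ | _ = inj₁ (d / 2 , trans d≡ (*-comm (d / 2) 2))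
  ... | 1           | _  | _ = inj₂ refl
  ... | suc (suc _) | _  | s≤s (s≤s ())

  odd⇒1⊎≥3 : ∀ {r} → r % 2 ≡ 1 → r ≡ 1 ⊎ 3 ≤ r
  odd⇒1⊎≥3 {1}                 _ = inj₁ refl
  odd⇒1⊎≥3 {suc (suc (suc _))} _ = inj₂ (s≤s (s≤s (s≤s z≤n)))

  odd≡ : ∀ {r} → r % 2 ≡ 1 → r ≡ 1 + 2 * (r / 2)
  odd≡ {r} odd = trans (m≡m%n+[m/n]*n r 2) (cong₂ _+_ odd (*-comm (r / 2) 2))

  odd∣ : ∀ {d m} → d % 2 ≡ 1 → d ∣ 2 * m → d ∣ m
  odd∣ {d} {m} odd d∣2m = ∣m+n∣m⇒∣n (subst (d ∣_) dm≡ (m∣m*n m)) (∣n⇒∣m*n (d / 2) d∣2m)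
    where
      dm≡ : d * m ≡ d / 2 * (2 * m) + m
      dm≡ = trans (cong (_* m) (odd≡ {d} odd))
                  (solve 2 (λ h m → (con 1 :+ con 2 :* h) :* m := h :* (con 2 :* m) :+ m) refl (d / 2) m)

  -- Halving is possible modulo an odd number: 2 is invertible, with inverse 1 + r / 2.
  halve : ∀ {r} .{{_ : NonZero r}} → r % 2 ≡ 1 → ∀ {a b} → Mod._≋_ r (a + a) (b + b) → Mod._≋_ r a b
  halve {r} odd {a} {b} p = ≋-trans (≋-sym (undouble a)) (≋-trans (*-≋ (suc (r / 2)) p) (undouble b))
    where
      open Mod r
      undouble : ∀ x → suc (r / 2) * (x + x) ≋ x
      undouble x = ≋-trans (≡⇒≋ (begin
        suc (r / 2) * (x + x)         ≡⟨ solve 2 (λ h x → (con 1 :+ h) :* (x :+ x) := x :+ (con 1 :+ con 2 :* h) :* x) refl (r / 2) x ⟩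
        x + (1 + 2 * (r / 2)) * x     ≡⟨ cong (λ z → x + z * x) (odd≡ {r} odd) ⟨
        x + r * x                     ≡⟨ cong (x +_) (*-comm r x) ⟩
        x + x * r                     ∎)) (+kM-≋ x x)
        where open ≡-Reasoning

  halve₄ : ∀ {a b} → Mod._≋_ 4 (a + a) (b + b) → Mod._≋_ 2 a b
  halve₄ {a} {b} p = *-cancelʳ-≡ (a % 2) (b % 2) 2 (begin
    a % 2 * 2      ≡⟨ m%n*o≡m*o%[n*o] a 2 2 ⟩
    (a * 2) % 4    ≡⟨ cong (_% 4) (double a) ⟨
    (a + a) % 4    ≡⟨ p ⟩
    (b + b) % 4    ≡⟨ cong (_% 4) (double b) ⟩
    (b * 2) % 4    ≡⟨ m%n*o≡m*o%[n*o] b 2 2 ⟨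
    b % 2 * 2      ∎)
    where
      open ≡-Reasoning
      double : ∀ x → x + x ≡ x * 2
      double x = solve 1 (λ x → x :+ x := x :* con 2) refl x

  divisor-of-2^ : ∀ a {d} → d ∣ 2 ^ a → d ≡ 1 ⊎ d ≡ 2 ⊎ 4 ∣ d
  divisor-of-2^ zero    d∣1 = inj₁ (∣1⇒≡1 d∣1)
  divisor-of-2^ (suc a) {d} d∣ with even-or-odd d
  ... | inj₂ odd = divisor-of-2^ a (odd∣ odd d∣)
  ... | inj₁ (e , refl) with divisor-of-2^ a {e} (*-cancelˡ-∣ 2 d∣)
  ...   | inj₁ refl          = inj₂ (inj₁ refl)
  ...   | inj₂ (inj₁ refl)   = inj₂ (inj₂ ∣-refl)
  ...   | inj₂ (inj₂ 4∣e)    = inj₂ (inj₂ (∣n⇒∣m*n 2 4∣e))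

  2^-mono-∣ : ∀ {c a} → c ≤ a → 2 ^ c ∣ 2 ^ a
  2^-mono-∣ {c} {a} c≤a = divides (2 ^ (a ∸ c))
    (trans (cong (2 ^_) (sym (m∸n+n≡m c≤a))) (^-distribˡ-+-* 2 (a ∸ c) c))

  record OddDecomposition (n : ℕ) : Set where
    field
      exponent oddPart : ℕ
      decomposition    : n ≡ 2 ^ exponent * oddPart
      oddPart-odd      : oddPart % 2 ≡ 1

  oddDecomposition : ∀ n → 0 < n → OddDecomposition n
  oddDecomposition n = go n (<-wellFounded n)
    where
      go : ∀ n → Acc _<_ n → 0 < n → OddDecomposition n
      go n (acc rec) 0<n with even-or-odd n
      ... | inj₂ odd = record { exponent = 0 ; oddPart = n ; decomposition = sym (+-identityʳ n) ; oddPart-odd = odd }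
      ... | inj₁ (e , refl) =
        record { exponent = suc exponent ; oddPart = oddPart
               ; decomposition = trans (cong (2 *_) decomposition) (sym (*-assoc 2 (2 ^ exponent) oddPart))
               ; oddPart-odd = oddPart-odd }
        where
          0<e : 0 < e
          0<e = *-cancelˡ-< 2 0 e 0<n
          open OddDecomposition (go e (rec (subst (e <_) (*-comm e 2) (m<m*n e 2 {{>-nonZero 0<e}} ≤-refl))) 0<e)

-- Subgroups of ℤ/n, given as sets of exponents, are generated by a divisor of n.
module ExponentGroups where

  open import Data.Nat
  open import Data.Nat.Properties
  open import Data.Nat.DivMod
  open import Data.Nat.Divisibility
  open import Data.Sum using (_⊎_; inj₁; inj₂; [_,_]′)
  open import Data.Empty using (⊥-elim)
  open import Relation.Nullary using (¬_; Dec; yes; no)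
  open import Relation.Binary.PropositionalEquality
  open Congruence

  record LeastPositive (P : ℕ → Set) : Set where
    field
      value    : ℕ
      positive : 0 < value
      holds    : P value
      minimal  : ∀ {s} → 0 < s → s < value → ¬ P s

  leastPositive : ∀ {P : ℕ → Set} → (∀ s → Dec (P s)) → ∀ {k} → 0 < k → P k → LeastPositive P
  leastPositive {P} P? {k} 0<k Pk with search k
    where
      search : ∀ k → LeastPositive P ⊎ (∀ {s} → 0 < s → s ≤ k → ¬ P s)
      search zero = inj₂ λ 0<s s≤0 _ → <-irrefl refl (<-≤-trans 0<s s≤0)
      search (suc k) with search k
      ... | inj₁ least = inj₁ least
      ... | inj₂ none with P? (suc k)
      ...   | yes p = inj₁ (record { value = suc k ; positive = z<s ; holds = p
                                   ; minimal = λ 0<s s<1+k → none 0<s (s≤s⁻¹ s<1+k) })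
      ...   | no ¬p = inj₂ λ {s} 0<s s≤1+k → [ (λ s<1+k → none 0<s (s≤s⁻¹ s<1+k)) , (λ { refl → ¬p }) ]′
                                                (m≤n⇒m<n∨m≡n s≤1+k)
  ... | inj₁ least = least
  ... | inj₂ none  = ⊥-elim (none 0<k ≤-refl Pk)

  record ExponentGroup (n : ℕ) .{{_ : NonZero n}} (T : ℕ → Set) : Set where
    open Mod n
    field
      decide   : ∀ t → Dec (T t)
      zero∈    : T 0
      resp-≋     : ∀ {a b} → a ≋ b → T a → T b
      +-closed : ∀ {a b} → T a → T b → T (a + b)
      cancel   : ∀ {a b} → T (a + b) → T b → T a

  record Generator (n : ℕ) (T : ℕ → Set) : Set where
    field
      d     : ℕ
      d>0   : 0 < d
      d∣n   : d ∣ n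
      sound : ∀ t → T t → d ∣ t
      complete : ∀ t → d ∣ t → T t

  -- Only the specification of the generator matters; keeping it opaque stops
  -- the type checker from unfolding the search that computes it.
  opaque
    generator : ∀ {n} .{{_ : NonZero n}} {T : ℕ → Set} → ExponentGroup n T → Generator n T
    generator {n} {T} G = record { d = d ; d>0 = d>0 ; d∣n = sound n T-n ; sound = sound ; complete = complete }
      where
        open Mod n
        open ExponentGroup G
        T-n : T n
        T-n = resp-≋ (≋-sym M≋0) zero∈
        open LeastPositive (leastPositive decide (>-nonZero⁻¹ n) T-n)
          renaming (value to d; positive to d>0; holds to T-d)
        instance
          d≢0 : NonZero d
          d≢0 = >-nonZero d>0

        multiples : ∀ k → T (k * d)
        multiples zero    = zero∈
        multiples (suc k) = +-closed T-d (multiples k)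

        complete : ∀ t → d ∣ t → T t
        complete t (divides k refl) = multiples k

        -- The remainder t % d lies in T, so it cannot be positive.
        sound : ∀ t → T t → d ∣ t
        sound t Tt with t % d in r≡ | cancel (subst T (m≡m%n+[m/n]*n t d) Tt) (multiples (t / d))
        ... | zero  | _   = m%n≡0⇒n∣m t d r≡
        ... | suc r | T-r = ⊥-elim (minimal z<s (subst (_< d) r≡ (m%n<n t d)) (subst T r≡ T-r))

-- σ(n) counts the pairs (d , i) with d ∣ n and i < d; a lower bound for σ(n).
module DivisorPairs where

  open import Data.Nat
  open import Data.Nat.Properties
  open import Data.Nat.Divisibility
  open import Data.Fin using (Fin)
  open import Data.Product using (∃; _×_; _,_; proj₁; proj₂)
  open import Data.Sum using (inj₁; inj₂)
  open import Data.Empty using (⊥-elim)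
  open import Relation.Nullary using (¬_)
  open import Relation.Binary.PropositionalEquality
  open import Data.List using (List; []; _∷_; _++_; map; length; filter; applyUpTo; upTo; concatMap; allFin)
  open import Data.List.Properties using (length-++; length-map; length-upTo; length-tabulate)
  open import Data.List.Membership.Propositional using (_∈_)
  open import Data.List.Membership.Propositional.Properties
  open import Data.List.Relation.Unary.Any using (here; there)
  import Data.List.Relation.Unary.Any as Any
  open import Data.List.Relation.Unary.All using (lookup)
  open import Data.List.Relation.Unary.AllPairs using (_∷_)
  open import Data.List.Relation.Unary.Unique.Propositional using (Unique)
  import Data.List.Relation.Unary.Unique.Propositional.Properties as Unique
  open import Data.Nat.ListAction using (sum)
  open import Data.Nat.Solver using (module +-*-Solver)
  open +-*-Solver using (solve; _:+_; _:*_; _:=_; con)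
  open import Defs using (σ)
  open NumberTheory using (2^-mono-∣)

  module _ {A : Set} where

    delete : ∀ {x : A} (ys : List A) → x ∈ ys → List A
    delete (y ∷ ys) (here _)  = ys
    delete (y ∷ ys) (there p) = y ∷ delete ys p

    length-delete : ∀ {x : A} (ys : List A) (p : x ∈ ys) → suc (length (delete ys p)) ≡ length ys
    length-delete (y ∷ ys) (here _)  = refl
    length-delete (y ∷ ys) (there p) = cong suc (length-delete ys p)

    ∈-delete : ∀ {x z : A} (ys : List A) → z ∈ ys → z ≢ x → (p : x ∈ ys) → z ∈ delete ys p
    ∈-delete (y ∷ ys) (here z≡y) z≢x (here x≡y) = ⊥-elim (z≢x (trans z≡y (sym x≡y)))
    ∈-delete (y ∷ ys) (here z≡y) z≢x (there p)  = here z≡y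
    ∈-delete (y ∷ ys) (there q)  z≢x (here _)   = q
    ∈-delete (y ∷ ys) (there q)  z≢x (there p)  = there (∈-delete ys q z≢x p)

    unique⊆⇒length≤ : ∀ (xs ys : List A) → Unique xs → (∀ {z} → z ∈ xs → z ∈ ys) → length xs ≤ length ys
    unique⊆⇒length≤ []       ys _          _   = z≤n
    unique⊆⇒length≤ (x ∷ xs) ys (x∉xs ∷ u) xs⊆ys =
      subst (suc (length xs) ≤_) (length-delete ys x∈ys)
        (s≤s (unique⊆⇒length≤ xs (delete ys x∈ys) u
          (λ z∈xs → ∈-delete ys (xs⊆ys (there z∈xs)) (λ z≡x → lookup x∉xs z∈xs (sym z≡x)) x∈ys)))
      where x∈ys = xs⊆ys (here refl)

  Pair : Set
  Pair = ℕ × ℕ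

  block : ℕ → List Pair
  block d = map (d ,_) (upTo d)

  length-block : ∀ d → length (block d) ≡ d
  length-block d = trans (length-map _ (upTo d)) (length-upTo d)

  ∈-block⁻ : ∀ {d x} → x ∈ block d → proj₁ x ≡ d × proj₂ x < d
  ∈-block⁻ {d} p with ∈-map⁻ (d ,_) p
  ... | i , i∈ , refl = refl , ∈-upTo⁻ i∈

  unique-block : ∀ d → Unique (block d)
  unique-block d = Unique.map⁺ (cong proj₂) (Unique.upTo⁺ d)

  DivisorPair : ℕ → Pair → Set
  DivisorPair n (d , i) = d ∣ n × i < d

  divisorPairs : ℕ → List Pair
  divisorPairs n = concatMap block (filter (_∣? n) (applyUpTo suc n))

  length-divisorPairs : ∀ n → length (divisorPairs n) ≡ σ n
  length-divisorPairs n = go (filter (_∣? n) (applyUpTo suc n))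
    where
      go : ∀ ds → length (concatMap block ds) ≡ sum ds
      go []       = refl
      go (d ∷ ds) = trans (length-++ (block d)) (cong₂ _+_ (length-block d) (go ds))

  ∈-divisorPairs : ∀ {n} .{{_ : NonZero n}} {x} → DivisorPair n x → x ∈ divisorPairs n
  ∈-divisorPairs {n} {zero , i} (_ , ())
  ∈-divisorPairs {n} {suc d , i} (d∣n , i<d) =
    ∈-concatMap⁺ block (Any.map (λ { refl → ∈-map⁺ _ (∈-upTo⁺ i<d) })
      (∈-filter⁺ (_∣? n) (∈-applyUpTo⁺ suc (∣⇒≤ d∣n)) d∣n))

  multiplePairs : ℕ → ℕ → List Pair
  multiplePairs r zero    = block r
  multiplePairs r (suc a) = multiplePairs r a ++ block (r * 2 ^ suc a)

  length-multiplePairs : ∀ r a → length (multiplePairs r a) + r ≡ 2 * (r * 2 ^ a)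
  length-multiplePairs r zero =
    trans (cong (_+ r) (length-block r)) (solve 1 (λ r → r :+ r := con 2 :* (r :* con 1)) refl r)
  length-multiplePairs r (suc a) = begin
    length (multiplePairs r a ++ block X) + r     ≡⟨ cong (_+ r) (length-++ (multiplePairs r a)) ⟩
    length (multiplePairs r a) + length (block X) + r
                                                  ≡⟨ cong (λ z → length (multiplePairs r a) + z + r) (length-block X) ⟩
    length (multiplePairs r a) + X + r            ≡⟨ solve 3 (λ l x r → l :+ x :+ r := (l :+ r) :+ x) refl (length (multiplePairs r a)) X r ⟩
    (length (multiplePairs r a) + r) + X          ≡⟨ cong (_+ X) (length-multiplePairs r a) ⟩
    2 * (r * 2 ^ a) + r * (2 * 2 ^ a)             ≡⟨ solve 2 (λ r t → con 2 :* (r :* t) :+ r :* (con 2 :* t) := con 2 :* (r :* (con 2 :* t))) refl r (2 ^ a) ⟩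
    2 * (r * 2 ^ suc a)                           ∎
    where
      open ≡-Reasoning
      X = r * 2 ^ suc a

  ∈-multiplePairs⁻ : ∀ r a {x} → x ∈ multiplePairs r a →
                     ∃ λ k → k ≤ a × proj₁ x ≡ r * 2 ^ k × proj₂ x < proj₁ x
  ∈-multiplePairs⁻ r zero p with ∈-block⁻ p
  ... | d≡r , i<r = 0 , z≤n , trans d≡r (sym (*-identityʳ r)) , subst (_ <_) (sym d≡r) i<r
  ∈-multiplePairs⁻ r (suc a) p with ∈-++⁻ (multiplePairs r a) p
  ... | inj₁ q with ∈-multiplePairs⁻ r a q
  ...   | k , k≤a , d≡ , i<d = k , m≤n⇒m≤1+n k≤a , d≡ , i<d
  ∈-multiplePairs⁻ r (suc a) p | inj₂ q with ∈-block⁻ q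
  ...   | d≡ , i<d = suc a , ≤-refl , d≡ , subst (_ <_) (sym d≡) i<d

  unique-multiplePairs : ∀ r .{{_ : NonZero r}} a → Unique (multiplePairs r a)
  unique-multiplePairs r zero    = unique-block r
  unique-multiplePairs r (suc a) = Unique.++⁺ (unique-multiplePairs r a) (unique-block _) disjoint
    where
      -- Earlier blocks have strictly smaller first entries.
      disjoint : ∀ {x} → ¬ (x ∈ multiplePairs r a × x ∈ block (r * 2 ^ suc a))
      disjoint (p , q) with ∈-multiplePairs⁻ r a p | ∈-block⁻ q
      ... | k , k≤a , d≡ , _ | d≡′ , _ = <-irrefl (trans (sym d≡) d≡′) (begin-strict
            r * 2 ^ k      ≤⟨ *-monoʳ-≤ r (^-monoʳ-≤ 2 k≤a) ⟩
            r * 2 ^ a      <⟨ *-monoʳ-< r (m<m*n (2 ^ a) 2 {{m^n≢0 2 a}} ≤-refl) ⟩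
            r * (2 ^ a * 2) ≡⟨ cong (r *_) (*-comm (2 ^ a) 2) ⟩
            r * 2 ^ suc a  ∎)
        where open ≤-Reasoning

  -- Let n = 2^a r.  If f picks r distinct
  -- divisor pairs whose first entries are not multiples of r, then σ n ≥ 2n,
  -- because the divisor pairs with first entry r·2^k contribute 2n − r more.
  σ≥2n : ∀ {n a r} .{{_ : NonZero n}} .{{_ : NonZero r}} → n ≡ 2 ^ a * r →
         (f : Fin r → Pair) → (∀ {c c′} → f c ≡ f c′ → c ≡ c′) →
         (∀ c → DivisorPair n (f c)) → (∀ c → ¬ r ∣ proj₁ (f c)) → 2 * n ≤ σ n
  σ≥2n {n} {a} {r} n≡ f f-inj f-div f-∤ =
    subst₂ _≤_ length-pairs (length-divisorPairs n)
      (unique⊆⇒length≤ pairs (divisorPairs n) unique-pairs pairs⊆divisorPairs)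
    where
      pairs : List Pair
      pairs = map f (allFin r) ++ multiplePairs r a

      multiple-div : ∀ {x} → x ∈ multiplePairs r a → DivisorPair n x
      multiple-div p with ∈-multiplePairs⁻ r a p
      ... | k , k≤a , d≡ , i<d =
        subst (_∣ n) (sym d≡) (subst (r * 2 ^ k ∣_) (trans (*-comm r (2 ^ a)) (sym n≡))
          (*-monoʳ-∣ r (2^-mono-∣ k≤a))) , i<d

      disjoint : ∀ {x} → ¬ (x ∈ map f (allFin r) × x ∈ multiplePairs r a)
      disjoint (p , q) with ∈-map⁻ f p | ∈-multiplePairs⁻ r a q
      ... | c , _ , refl | k , _ , d≡ , _ = f-∤ c (subst (r ∣_) (sym d≡) (m∣m*n (2 ^ k)))

      unique-pairs : Unique pairs
      unique-pairs = Unique.++⁺ (Unique.map⁺ f-inj (Unique.allFin⁺ r)) (unique-multiplePairs r a) disjoint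

      pairs⊆divisorPairs : ∀ {x} → x ∈ pairs → x ∈ divisorPairs n
      pairs⊆divisorPairs p with ∈-++⁻ (map f (allFin r)) p
      ... | inj₁ q with ∈-map⁻ f q
      ...   | c , _ , refl = ∈-divisorPairs (f-div c)
      pairs⊆divisorPairs p | inj₂ q = ∈-divisorPairs (multiple-div q)

      length-pairs : length pairs ≡ 2 * n
      length-pairs = begin
        length pairs                                      ≡⟨ length-++ (map f (allFin r)) ⟩
        length (map f (allFin r)) + length (multiplePairs r a)
                                                          ≡⟨ cong (_+ length (multiplePairs r a)) (trans (length-map f (allFin r)) (length-tabulate _)) ⟩
        r + length (multiplePairs r a)                    ≡⟨ +-comm r _ ⟩
        length (multiplePairs r a) + r                    ≡⟨ length-multiplePairs r a ⟩
        2 * (r * 2 ^ a)                                   ≡⟨ cong (2 *_) (trans (*-comm r (2 ^ a)) (sym n≡)) ⟩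
        2 * n                                             ∎
        where open ≡-Reasoning

module Walks where

  open import Data.Nat
  open import Data.Nat.Properties
  open import Data.Nat.DivMod
  open import Data.Fin using (Fin; toℕ)
  open import Data.Fin.Properties using (toℕ<n)
  open import Data.Bool using (Bool; true; false)
  open import Data.Product using (Σ; _×_; _,_)
  open import Data.Sum using (_⊎_; inj₁; inj₂)
  open import Relation.Binary.PropositionalEquality
  open Congruence

  module CycleWalk (N : ℕ) .{{_ : NonZero N}} (special : Fin N → Bool) (cls : Fin N → ℕ) where
    open Mod N
    open FinMod N

    next : Fin N → Fin N
    next p = suc (toℕ p) mod N

    next-injective : ∀ {p q} → next p ≡ next q → p ≡ q
    next-injective {p} {q} eq = fin-≋ p q (cancelˡ {c = 1}
      (≋-trans (≋-sym (mod-≋ (suc (toℕ p)))) (≋-trans (≡⇒≋ (cong toℕ eq)) (mod-≋ (suc (toℕ q))))))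

    Exit : ℕ → Set
    Exit c = Σ (Fin N) λ q → special q ≡ false × cls q ≡ c × special (next q) ≡ true

    _⊕_ : Fin N → ℕ → Fin N
    p ⊕ k = (toℕ p + k) mod N

    ⊕-zero : ∀ p → p ⊕ 0 ≡ p
    ⊕-zero p = fin-≋ _ _ (≋-trans (mod-≋ _) (≡⇒≋ (+-identityʳ (toℕ p))))

    next-⊕ : ∀ p k → next (p ⊕ k) ≡ p ⊕ suc k
    next-⊕ p k = fin-≋ _ _ (≋-trans (mod-≋ _) (≋-trans (+-≋ {1} ≋-refl (mod-≋ (toℕ p + k)))
                   (≋-trans (≡⇒≋ (sym (+-suc (toℕ p) k))) (≋-sym (mod-≋ _)))))

    ⊕-reach : ∀ p q → p ⊕ (toℕ q + (N ∸ toℕ p)) ≡ q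
    ⊕-reach p q = fin-≋ _ _ (≋-trans (mod-≋ _) (≋-trans (≡⇒≋ (begin
      toℕ p + (toℕ q + (N ∸ toℕ p))  ≡⟨ +-comm (toℕ p) _ ⟩
      toℕ q + (N ∸ toℕ p) + toℕ p    ≡⟨ +-assoc (toℕ q) _ _ ⟩
      toℕ q + ((N ∸ toℕ p) + toℕ p)  ≡⟨ cong (toℕ q +_) (m∸n+n≡m (<⇒≤ (toℕ<n p))) ⟩
      toℕ q + N                      ∎)) (+M-≋ (toℕ q))))
      where open ≡-Reasoning

    module _ (stable : ∀ p → special p ≡ false → special (next p) ≡ false → cls (next p) ≡ cls p) where

      private
        Stays : Fin N → Fin N → Set
        Stays p q = special q ≡ false × cls q ≡ cls p

        walk-steps : ∀ p → special p ≡ false → ∀ k → Stays p (p ⊕ k) ⊎ Exit (cls p)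
        walk-steps p np zero = inj₁ (subst (Stays p) (sym (⊕-zero p)) (np , refl))
        walk-steps p np (suc k) with walk-steps p np k
        ... | inj₂ exit = inj₂ exit
        ... | inj₁ (nq , q∼p) with special (p ⊕ suc k) in e
        ...   | true  = inj₂ (p ⊕ k , nq , q∼p , trans (cong special (next-⊕ p k)) e)
        ...   | false = inj₁ (refl , (begin
                cls (p ⊕ suc k)     ≡⟨ cong cls (next-⊕ p k) ⟨
                cls (next (p ⊕ k))  ≡⟨ stable (p ⊕ k) nq (trans (cong special (next-⊕ p k)) e) ⟩
                cls (p ⊕ k)         ≡⟨ q∼p ⟩
                cls p               ∎))
          where open ≡-Reasoning

      walk : ∀ p q → special p ≡ false → cls q ≡ cls p ⊎ Exit (cls p)
      walk p q np with walk-steps p np (toℕ q + (N ∸ toℕ p))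
      ... | inj₂ exit = inj₂ exit
      ... | inj₁ (_ , q∼p) = inj₁ (trans (cong cls (sym (⊕-reach p q))) q∼p)

module DihedralSubgroups where

  open import Data.Nat
  open import Data.Nat.Properties
  open import Data.Nat.DivMod
  open import Data.Nat.Divisibility
  open import Data.Fin using (Fin; toℕ)
  import Data.Fin as Fin
  open import Data.Fin.Properties using (toℕ<n; any?)
  import Data.Nat as ℕ
  open import Data.Bool.Properties using (⇔→≡)
  open import Function.Bundles using (mk⇔)
  open import Data.Empty using (⊥-elim)
  open import Relation.Nullary using (¬_; Dec; yes; no; does)
  open import Relation.Nullary.Decidable using (dec-true)
  open import Data.Bool using (true; false)
  import Data.Bool as Bool
  open import Data.Product using (Σ; _,_; proj₂)
  open import Relation.Binary.PropositionalEquality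
  open import Defs
  open Congruence
  open ExponentGroups
  open import Data.Nat.Solver using (module +-*-Solver)
  open +-*-Solver using (solve; _:+_; _:=_)

  module Coordinates (n : ℕ) .{{_ : NonZero n}} where
    open Mod n
    open FinMod n

    _⊞_ : Fin n → Fin n → Fin n
    i ⊞ j = (toℕ i + toℕ j) mod n

    _⊟_ : Fin n → Fin n → Fin n
    i ⊟ j = (toℕ i + (n ∸ toℕ j)) mod n

    0ᶠ : Fin n
    0ᶠ = 0 mod n

    ⊞-spec : ∀ i j → toℕ (i ⊞ j) ≋ toℕ i + toℕ j
    ⊞-spec i j = mod-≋ _

    ⊟-spec : ∀ i j → toℕ (i ⊟ j) + toℕ j ≋ toℕ i
    ⊟-spec i j = begin
      toℕ (i ⊟ j) + toℕ j              ≈⟨ +-≋ {toℕ (i ⊟ j)} (mod-≋ _) ≋-refl ⟩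
      toℕ i + (n ∸ toℕ j) + toℕ j      ≡⟨ +-assoc (toℕ i) _ _ ⟩
      toℕ i + ((n ∸ toℕ j) + toℕ j)    ≡⟨ cong (toℕ i +_) (m∸n+n≡m (<⇒≤ (toℕ<n j))) ⟩
      toℕ i + n                        ≈⟨ +M-≋ (toℕ i) ⟩
      toℕ i                            ∎
      where open ≋-Reasoning

    0ᶠ-spec : toℕ 0ᶠ ≋ 0
    0ᶠ-spec = mod-≋ 0

    -- Conjugation g h g⁻¹, and its effect on exponents:
    -- a^s a^t a^-s = a^t,  (a^s b) a^t (a^s b)⁻¹ = a^-t,
    -- a^s (a^j b) a^-s = a^(j+2s) b,  (a^s b)(a^j b)(a^s b)⁻¹ = a^(2s-j) b.
    conj : D n → D n → D n
    conj g h = mul n (mul n g h) (inv n g)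

    neg-spec : ∀ s → toℕ (0ᶠ ⊟ s) + toℕ s ≋ 0
    neg-spec s = ≋-trans (⊟-spec 0ᶠ s) 0ᶠ-spec

    conj-rot-rot : ∀ s t → toℕ (proj₂ (conj (false , s) (false , t))) ≋ toℕ t
    conj-rot-rot s t = cancelʳ {c = toℕ s} (begin
      toℕ ((s ⊞ t) ⊞ (0ᶠ ⊟ s)) + toℕ s          ≈⟨ +-≋ {toℕ ((s ⊞ t) ⊞ (0ᶠ ⊟ s))} (⊞-spec (s ⊞ t) (0ᶠ ⊟ s)) ≋-refl ⟩
      toℕ (s ⊞ t) + toℕ (0ᶠ ⊟ s) + toℕ s        ≡⟨ +-assoc (toℕ (s ⊞ t)) _ _ ⟩
      toℕ (s ⊞ t) + (toℕ (0ᶠ ⊟ s) + toℕ s)      ≈⟨ +-≋ {toℕ (s ⊞ t)} (⊞-spec s t) (neg-spec s) ⟩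
      toℕ s + toℕ t + 0                         ≡⟨ trans (+-identityʳ _) (+-comm (toℕ s) (toℕ t)) ⟩
      toℕ t + toℕ s                             ∎)
      where open ≋-Reasoning

    conj-ref-rot : ∀ s t → toℕ (proj₂ (conj (true , s) (false , t))) + toℕ t ≋ 0
    conj-ref-rot s t = cancelʳ {c = toℕ s} (begin
      toℕ ((s ⊟ t) ⊟ s) + toℕ t + toℕ s       ≡⟨ +-assoc (toℕ ((s ⊟ t) ⊟ s)) _ _ ⟩
      toℕ ((s ⊟ t) ⊟ s) + (toℕ t + toℕ s)     ≡⟨ cong (toℕ ((s ⊟ t) ⊟ s) +_) (+-comm (toℕ t) (toℕ s)) ⟩
      toℕ ((s ⊟ t) ⊟ s) + (toℕ s + toℕ t)     ≡⟨ +-assoc (toℕ ((s ⊟ t) ⊟ s)) _ _ ⟨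
      toℕ ((s ⊟ t) ⊟ s) + toℕ s + toℕ t       ≈⟨ +-≋ {toℕ ((s ⊟ t) ⊟ s) + toℕ s} (⊟-spec (s ⊟ t) s) ≋-refl ⟩
      toℕ (s ⊟ t) + toℕ t                     ≈⟨ ⊟-spec s t ⟩
      toℕ s                                   ∎)
      where open ≋-Reasoning

    conj-rot-ref : ∀ s j → toℕ (proj₂ (conj (false , s) (true , j))) ≋ toℕ j + (toℕ s + toℕ s)
    conj-rot-ref s j = begin
      toℕ u                                   ≡⟨ +-identityʳ (toℕ u) ⟨
      toℕ u + 0                               ≈⟨ +-≋ {toℕ u} ≋-refl (neg-spec s) ⟨
      toℕ u + (toℕ (0ᶠ ⊟ s) + toℕ s)          ≡⟨ +-assoc (toℕ u) _ _ ⟨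
      toℕ u + toℕ (0ᶠ ⊟ s) + toℕ s            ≈⟨ +-≋ {toℕ u + toℕ (0ᶠ ⊟ s)} (≋-trans (⊟-spec (s ⊞ j) (0ᶠ ⊟ s)) (⊞-spec s j)) ≋-refl ⟩
      toℕ s + toℕ j + toℕ s                   ≡⟨ cong (_+ toℕ s) (+-comm (toℕ s) (toℕ j)) ⟩
      toℕ j + toℕ s + toℕ s                   ≡⟨ +-assoc (toℕ j) _ _ ⟩
      toℕ j + (toℕ s + toℕ s)                 ∎
      where
        open ≋-Reasoning
        u = (s ⊞ j) ⊟ (0ᶠ ⊟ s)

    conj-ref-ref : ∀ s j → toℕ (proj₂ (conj (true , s) (true , j))) + toℕ j ≋ toℕ s + toℕ s
    conj-ref-ref s j = begin
      toℕ ((s ⊟ j) ⊞ s) + toℕ j               ≈⟨ +-≋ {toℕ ((s ⊟ j) ⊞ s)} (⊞-spec (s ⊟ j) s) ≋-refl ⟩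
      toℕ (s ⊟ j) + toℕ s + toℕ j             ≡⟨ +-assoc (toℕ (s ⊟ j)) _ _ ⟩
      toℕ (s ⊟ j) + (toℕ s + toℕ j)           ≡⟨ cong (toℕ (s ⊟ j) +_) (+-comm (toℕ s) (toℕ j)) ⟩
      toℕ (s ⊟ j) + (toℕ j + toℕ s)           ≡⟨ +-assoc (toℕ (s ⊟ j)) _ _ ⟨
      toℕ (s ⊟ j) + toℕ j + toℕ s             ≈⟨ +-≋ {toℕ (s ⊟ j) + toℕ j} (⊟-spec s j) ≋-refl ⟩
      toℕ s + toℕ s                           ∎
      where open ≋-Reasoning

  module SubgroupStructure (n : ℕ) .{{_ : NonZero n}} (H : Subset n) (sg : IsSubgroup n H) where
    open Mod n
    open FinMod n
    open Coordinates n
    open IsSubgroup sg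

    RotExp : ℕ → Set
    RotExp t = H (false , t mod n) ≡ true

    rotExp-intro : ∀ x a → toℕ x ≋ a → H (false , x) ≡ true → RotExp a
    rotExp-intro x a x≋a = subst (λ z → H (false , z) ≡ true) (fin-≋ x (a mod n) (≋-trans x≋a (≋-sym (mod-≋ a))))

    rotExp-group : ExponentGroup n RotExp
    rotExp-group = record
      { decide   = λ t → H (false , t mod n) Bool.≟ true
      ; zero∈    = one-mem
      ; resp-≋   = λ a≋b → subst (λ z → H (false , z) ≡ true) (mod-cong a≋b)
      ; +-closed = λ {a} {b} ha hb → rotExp-intro _ (a + b)
                     (≋-trans (⊞-spec (a mod n) (b mod n)) (+-≋ (mod-≋ a) (mod-≋ b))) (mul-mem _ _ ha hb)
      ; cancel   = λ {a} {b} hab hb → rotExp-intro _ a (difference a b) (mul-mem _ _ hab (inv-mem _ hb))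
      }
      where
        difference : ∀ a b → toℕ (((a + b) mod n) ⊞ (0ᶠ ⊟ (b mod n))) ≋ a
        difference a b = cancelʳ {c = b} (begin
          toℕ (A ⊞ B) + b              ≈⟨ +-≋ {toℕ (A ⊞ B)} (⊞-spec A B) (≋-sym (mod-≋ b)) ⟩
          toℕ A + toℕ B + toℕ (b mod n) ≡⟨ +-assoc (toℕ A) _ _ ⟩
          toℕ A + (toℕ B + toℕ (b mod n)) ≈⟨ +-≋ {toℕ A} (mod-≋ (a + b)) (neg-spec (b mod n)) ⟩
          a + b + 0                    ≡⟨ +-identityʳ (a + b) ⟩
          a + b                        ∎)
          where
            open ≋-Reasoning
            A = (a + b) mod n
            B = 0ᶠ ⊟ (b mod n)

    open Generator (generator rotExp-group) public

    instance
      d≢0 : NonZero d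
      d≢0 = >-nonZero d>0

    rot∈⇒ : ∀ x → H (false , x) ≡ true → d ∣ toℕ x
    rot∈⇒ x h = sound (toℕ x) (subst (λ z → H (false , z) ≡ true) (sym (toℕ-mod-id x)) h)

    rot∈⇐ : ∀ x → d ∣ toℕ x → H (false , x) ≡ true
    rot∈⇐ x d∣x = subst (λ z → H (false , z) ≡ true) (toℕ-mod-id x) (complete (toℕ x) d∣x)

    trivial-rotations⇒d≡n : (∀ x → H (false , x) ≡ true → toℕ x ≡ 0) → d ≡ n
    trivial-rotations⇒d≡n only-0 = ∣-antisym d∣n (m%n≡0⇒n∣m d n (begin
      d % n              ≡⟨ toℕ-mod d ⟨
      toℕ (d mod n)      ≡⟨ only-0 (d mod n) (complete d ∣-refl) ⟩
      0                  ∎))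
      where open ≡-Reasoning

    module WithReflection (i₀ : Fin n) (i₀∈ : H (true , i₀) ≡ true) where
      module ModD = Mod d

      ≋⇒≋d : ∀ {a b} → a ≋ b → a ModD.≋ b
      ≋⇒≋d = weaken d∣n

      ref∈⇒ : ∀ j → H (true , j) ≡ true → toℕ j ModD.≋ toℕ i₀
      ref∈⇒ j j∈ = begin
        toℕ j                    ≈⟨ ModD.+-≋ {0} {toℕ (i₀ ⊟ j)} {toℕ j} (ModD.≋-sym (ModD.∣⇒≋0 (rot∈⇒ _ (mul-mem _ _ i₀∈ j∈)))) ModD.≋-refl ⟩
        toℕ (i₀ ⊟ j) + toℕ j     ≈⟨ ≋⇒≋d (⊟-spec i₀ j) ⟩
        toℕ i₀                   ∎
        where open ModD.≋-Reasoning

      ref∈⇐ : ∀ j → toℕ j ModD.≋ toℕ i₀ → H (true , j) ≡ true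
      ref∈⇐ j j≋i₀ = subst (λ z → H (true , z) ≡ true) i₀⊟w≡j (mul-mem (true , i₀) (false , w) i₀∈ w∈)
        where
          -- a^i₀ b · a^w = a^j b for the rotation a^w = (a^j b)(a^i₀ b) ∈ H.
          w : Fin n
          w = i₀ ⊟ j
          w∈ : H (false , w) ≡ true
          w∈ = rot∈⇐ w (ModD.≋0⇒∣ (ModD.cancelʳ {c = toℕ j} (begin
            toℕ w + toℕ j   ≈⟨ ≋⇒≋d (⊟-spec i₀ j) ⟩
            toℕ i₀          ≈⟨ j≋i₀ ⟨
            toℕ j           ∎)))
            where open ModD.≋-Reasoning
          i₀⊟w≡j : i₀ ⊟ w ≡ j
          i₀⊟w≡j = fin-≋ _ _ (cancelʳ {c = toℕ w} (begin
            toℕ (i₀ ⊟ w) + toℕ w   ≈⟨ ⊟-spec i₀ w ⟩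
            toℕ i₀                 ≈⟨ ⊟-spec i₀ j ⟨
            toℕ w + toℕ j          ≡⟨ +-comm (toℕ w) (toℕ j) ⟩
            toℕ j + toℕ w          ∎))
            where open ≋-Reasoning

      d≡1⇒full : d ≡ 1 → ∀ x → H x ≡ true
      d≡1⇒full d≡1 (false , x) = rot∈⇐ x (subst (_∣ toℕ x) (sym d≡1) (1∣ _))
      d≡1⇒full d≡1 (true , j)  = ref∈⇐ j (ModD.≋-trans (anything≋0 (toℕ j)) (ModD.≋-sym (anything≋0 (toℕ i₀))))
        where
          anything≋0 : ∀ a → a ModD.≋ 0
          anything≋0 a = ModD.∣⇒≋0 (subst (_∣ a) (sym d≡1) (1∣ a))

      double≋0 : d ∣ 2 → ∀ x → x + x ModD.≋ 0
      double≋0 d∣2 x = ModD.∣⇒≋0 (subst (d ∣_) (cong (x +_) (+-identityʳ x)) (∣m⇒∣m*n x d∣2))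

      -- For d ∣ 2 the subgroup is normal: conjugation changes exponents only by
      -- signs and by even amounts.
      d∣2⇒normal : d ∣ 2 → Normal n H
      d∣2⇒normal d∣2 (false , s) (false , t) t∈ = rot∈⇐ _ (ModD.≋0⇒∣ (begin
        toℕ (proj₂ (conj (false , s) (false , t)))   ≈⟨ ≋⇒≋d (conj-rot-rot s t) ⟩
        toℕ t                                       ≈⟨ ModD.∣⇒≋0 (rot∈⇒ t t∈) ⟩
        0                                           ∎))
        where open ModD.≋-Reasoning
      d∣2⇒normal d∣2 (true , s) (false , t) t∈ = rot∈⇐ _ (ModD.≋0⇒∣ (ModD.cancelʳ {c = toℕ t} (begin
        toℕ (proj₂ (conj (true , s) (false , t))) + toℕ t   ≈⟨ ≋⇒≋d (conj-ref-rot s t) ⟩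
        0                                                   ≈⟨ ModD.∣⇒≋0 (rot∈⇒ t t∈) ⟨
        toℕ t                                               ∎)))
        where open ModD.≋-Reasoning
      d∣2⇒normal d∣2 (false , s) (true , j) j∈ = ref∈⇐ _ (begin
        toℕ (proj₂ (conj (false , s) (true , j)))   ≈⟨ ≋⇒≋d (conj-rot-ref s j) ⟩
        toℕ j + (toℕ s + toℕ s)                     ≈⟨ ModD.+-≋ {toℕ j} ModD.≋-refl (double≋0 d∣2 (toℕ s)) ⟩
        toℕ j + 0                                   ≡⟨ +-identityʳ (toℕ j) ⟩
        toℕ j                                       ≈⟨ ref∈⇒ j j∈ ⟩
        toℕ i₀                                      ∎)
        where open ModD.≋-Reasoning
      d∣2⇒normal d∣2 (true , s) (true , j) j∈ = ref∈⇐ _ (ModD.≋-trans (ModD.cancelʳ {c = toℕ j} (begin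
        toℕ (proj₂ (conj (true , s) (true , j))) + toℕ j   ≈⟨ ≋⇒≋d (conj-ref-ref s j) ⟩
        toℕ s + toℕ s                                      ≈⟨ double≋0 d∣2 (toℕ s) ⟩
        0                                                  ≈⟨ double≋0 d∣2 (toℕ j) ⟨
        toℕ j + toℕ j                                      ∎)) (ref∈⇒ j j∈))
        where open ModD.≋-Reasoning

  module Vertices (n : ℕ) .{{_ : NonZero n}} where
    open Mod n
    open FinMod n
    open Coordinates n

    no-reflection⇒normal : (H : Subset n) → IsSubgroup n H → (∀ j → H (true , j) ≢ true) → Normal n H
    no-reflection⇒normal H sg no-ref g (true , j) j∈ = ⊥-elim (no-ref j j∈)
    no-reflection⇒normal H sg no-ref (false , s) (false , t) t∈ =
      subst (λ z → H (false , z) ≡ true) (sym (fin-≋ _ t (conj-rot-rot s t))) t∈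
    no-reflection⇒normal H sg no-ref (true , s) (false , t) t∈ =
      subst (λ z → H (false , z) ≡ true) (fin-≋ _ _ conjugate≋inverse) (IsSubgroup.inv-mem sg (false , t) t∈)
      where
        conjugate≋inverse : toℕ (0ᶠ ⊟ t) ≋ toℕ (proj₂ (conj (true , s) (false , t)))
        conjugate≋inverse = cancelʳ {c = toℕ t} (≋-trans (neg-spec t) (≋-sym (conj-ref-rot s t)))

    vertex-reflection : ∀ H → IsVertex n H → Σ (Fin n) λ i → H (true , i) ≡ true
    vertex-reflection H (sg , _ , ¬normal) with any? (λ j → H (true , j) Bool.≟ true)
    ... | yes found = found
    ... | no none   = ⊥-elim (¬normal (no-reflection⇒normal H sg (λ j j∈ → none (j , j∈))))

    same-invariants⇒same-set :
      ∀ H K (sgH : IsSubgroup n H) (sgK : IsSubgroup n K)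
        (i : Fin n) (i∈ : H (true , i) ≡ true) (j : Fin n) (j∈ : K (true , j) ≡ true) →
      let module SH = SubgroupStructure n H sgH
          module SK = SubgroupStructure n K sgK
      in (d≡ : SH.d ≡ SK.d) → toℕ i % SH.d ≡ toℕ j % SK.d → SameSet n H K
    same-invariants⇒same-set H K sgH sgK i i∈ j j∈ d≡ i≡j (false , x) =
      ⇔→≡ (mk⇔ (λ x∈ → SK.rot∈⇐ x (subst (_∣ toℕ x) d≡ (SH.rot∈⇒ x x∈)))
                (λ x∈ → SH.rot∈⇐ x (subst (_∣ toℕ x) (sym d≡) (SK.rot∈⇒ x x∈))))
      where
        module SH = SubgroupStructure n H sgH
        module SK = SubgroupStructure n K sgK
    same-invariants⇒same-set H K sgH sgK i i∈ j j∈ d≡ i≡j (true , k) =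
      ⇔→≡ (mk⇔ (λ k∈ → RK.ref∈⇐ k (trans (%-congʳ {{SK.d≢0}} {{SH.d≢0}} (sym d≡)) (trans (RH.ref∈⇒ k k∈) i≡j)))
                (λ k∈ → RH.ref∈⇐ k (trans (%-congʳ {{SH.d≢0}} {{SK.d≢0}} d≡) (trans (RK.ref∈⇒ k k∈) (sym i≡j)))))
      where
        module SH = SubgroupStructure n H sgH
        module SK = SubgroupStructure n K sgK
        module RH = SubgroupStructure.WithReflection n H sgH i i∈
        module RK = SubgroupStructure.WithReflection n K sgK j j∈

    reflectionGroup : Fin n → Subset n
    reflectionGroup c (false , x) = does (toℕ x ℕ.≟ 0)
    reflectionGroup c (true , j)  = does (j Fin.≟ c)

    private
      does⇒ : ∀ {A : Set} (a? : Dec A) → does a? ≡ true → A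
      does⇒ (yes a) _ = a

    reflectionGroup-rotation : ∀ {c} x → reflectionGroup c (false , x) ≡ true → toℕ x ≡ 0
    reflectionGroup-rotation x = does⇒ (toℕ x ℕ.≟ 0)

    private
      reflection-≡ : ∀ c j → reflectionGroup c (true , j) ≡ true → j ≡ c
      reflection-≡ c j = does⇒ (j Fin.≟ c)

      rotation-intro : ∀ {c} x → toℕ x ≋ 0 → reflectionGroup c (false , x) ≡ true
      rotation-intro x x≋0 = dec-true (toℕ x ℕ.≟ 0) (≋0⇒toℕ≡0 x x≋0)

      reflection-intro : ∀ c j → j ≡ c → reflectionGroup c (true , j) ≡ true
      reflection-intro c j = dec-true (j Fin.≟ c)

    reflectionGroup-subgroup : ∀ c → IsSubgroup n (reflectionGroup c)
    reflectionGroup-subgroup c = record { one-mem = rotation-intro {c} 0ᶠ 0ᶠ-spec ; mul-mem = mul-mem ; inv-mem = inv-mem }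
      where
        mul-mem : ∀ x y → reflectionGroup c x ≡ true → reflectionGroup c y ≡ true →
                  reflectionGroup c (mul n x y) ≡ true
        mul-mem (false , x) (false , y) x∈ y∈ = rotation-intro {c} _
          (≋-trans (⊞-spec x y) (≡⇒≋ (cong₂ _+_ (reflectionGroup-rotation {c} x x∈) (reflectionGroup-rotation {c} y y∈))))
        mul-mem (false , x) (true , j) x∈ j∈ = reflection-intro c _ (trans (fin-≋ _ _
          (≋-trans (⊞-spec x j) (≡⇒≋ (cong (_+ toℕ j) (reflectionGroup-rotation {c} x x∈))))) (reflection-≡ c j j∈))
        mul-mem (true , j) (false , x) j∈ x∈ = reflection-intro c _ (trans (fin-≋ _ _ (cancelʳ {c = toℕ x}
          (≋-trans (⊟-spec j x) (≡⇒≋ (sym (trans (cong (toℕ j +_) (reflectionGroup-rotation {c} x x∈)) (+-identityʳ (toℕ j))))))))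
          (reflection-≡ c j j∈))
        mul-mem (true , j) (true , k) j∈ k∈ = rotation-intro {c} _ (cancelʳ {c = toℕ k}
          (≋-trans (⊟-spec j k) (≡⇒≋ (cong toℕ (trans (reflection-≡ c j j∈) (sym (reflection-≡ c k k∈)))))))
        inv-mem : ∀ x → reflectionGroup c x ≡ true → reflectionGroup c (inv n x) ≡ true
        inv-mem (false , x) x∈ = rotation-intro {c} _ (cancelʳ {c = toℕ x}
          (≋-trans (neg-spec x) (≡⇒≋ (cong (0 +_) (sym (reflectionGroup-rotation {c} x x∈))))))
        inv-mem (true , j)  j∈ = j∈

    -- For n ≥ 3 it is a vertex: it misses a, and conjugating by a moves a^c b to a^(c+2) b.
    reflectionGroup-vertex : 3 ≤ n → ∀ c → IsVertex n (reflectionGroup c)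
    reflectionGroup-vertex 3≤n c = reflectionGroup-subgroup c , ((false , 1ᶠ) , a∉) , ¬normal
      where
        1ᶠ : Fin n
        1ᶠ = 1 mod n
        toℕ-1ᶠ : toℕ 1ᶠ ≡ 1
        toℕ-1ᶠ = trans (toℕ-mod 1) (m<n⇒m%n≡m (≤-trans (s≤s (s≤s z≤n)) 3≤n))
        a∉ : reflectionGroup c (false , 1ᶠ) ≢ true
        a∉ a∈ with trans (sym toℕ-1ᶠ) (reflectionGroup-rotation {c} 1ᶠ a∈)
        ... | ()
        ¬normal : ¬ Normal n (reflectionGroup c)
        ¬normal normal = 1+n≰n (≤-trans 3≤n (∣⇒≤ (≋0⇒∣ {2} (cancelˡ {c = toℕ c} (begin
          toℕ c + 2                                      ≡⟨ cong (λ z → toℕ c + (z + z)) toℕ-1ᶠ ⟨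
          toℕ c + (toℕ 1ᶠ + toℕ 1ᶠ)                      ≈⟨ conj-rot-ref 1ᶠ c ⟨
          toℕ (proj₂ (conj (false , 1ᶠ) (true , c)))     ≡⟨ cong toℕ (reflection-≡ c _ (normal (false , 1ᶠ) (true , c) (reflection-intro c c refl))) ⟩
          toℕ c                                          ≡⟨ +-identityʳ (toℕ c) ⟨
          toℕ c + 0                                      ∎)))))
          where open ≋-Reasoning

    -- If 2i ≢ 2j (mod M), then H and K do not permute: the element
    -- a^i b · a^j b = a^(i-j) of HK is not a product k h with k ∈ K, h ∈ H.
    non-permuting : ∀ {M} .{{_ : NonZero M}} H K (sgH : IsSubgroup n H) (sgK : IsSubgroup n K)
      (i : Fin n) (i∈ : H (true , i) ≡ true) (j : Fin n) (j∈ : K (true , j) ≡ true) →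
      M ∣ SubgroupStructure.d n H sgH → M ∣ SubgroupStructure.d n K sgK →
      ¬ Mod._≋_ M (toℕ i + toℕ i) (toℕ j + toℕ j) → ¬ Permute n H K
    non-permuting {M} H K sgH sgK i i∈ j j∈ M∣dH M∣dK 2i≢2j (HK⊆KH , _) =
      not-in-KH (HK⊆KH (mul n (true , i) (true , j)) ((true , i) , (true , j) , i∈ , j∈ , refl))
      where
        module ModM = Mod M
        module SH = SubgroupStructure n H sgH
        module SK = SubgroupStructure n K sgK
        module RH = SH.WithReflection i i∈
        module RK = SK.WithReflection j j∈

        ≋⇒≋M : ∀ {a b} → a ≋ b → a ModM.≋ b
        ≋⇒≋M = weaken (∣-trans M∣dH SH.d∣n)
        rotH : ∀ x → H (false , x) ≡ true → toℕ x ModM.≋ 0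
        rotH x x∈ = ModM.∣⇒≋0 (∣-trans M∣dH (SH.rot∈⇒ x x∈))
        rotK : ∀ x → K (false , x) ≡ true → toℕ x ModM.≋ 0
        rotK x x∈ = ModM.∣⇒≋0 (∣-trans M∣dK (SK.rot∈⇒ x x∈))
        refH : ∀ k → H (true , k) ≡ true → toℕ k ModM.≋ toℕ i
        refH k k∈ = weaken {{SH.d≢0}} M∣dH (RH.ref∈⇒ k k∈)
        refK : ∀ k → K (true , k) ≡ true → toℕ k ModM.≋ toℕ j
        refK k k∈ = weaken {{SK.d≢0}} M∣dK (RK.ref∈⇒ k k∈)

        S = toℕ (i ⊟ j)
        S+j≋i : S + toℕ j ModM.≋ toℕ i
        S+j≋i = ≋⇒≋M (⊟-spec i j)

        not-in-KH : ¬ InProd n K H (mul n (true , i) (true , j))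
        not-in-KH ((false , u) , (false , v) , u∈ , v∈ , i⊟j≡u⊞v) = 2i≢2j (ModM.+-≋ {toℕ i} i≋j i≋j)
          where
            open ModM.≋-Reasoning
            i≋j : toℕ i ModM.≋ toℕ j
            i≋j = begin
              toℕ i                  ≈⟨ S+j≋i ⟨
              S + toℕ j              ≡⟨ cong (λ z → toℕ (proj₂ z) + toℕ j) i⊟j≡u⊞v ⟩
              toℕ (u ⊞ v) + toℕ j    ≈⟨ ModM.+-≋ {toℕ (u ⊞ v)} (≋⇒≋M (⊞-spec u v)) ModM.≋-refl ⟩
              toℕ u + toℕ v + toℕ j  ≈⟨ ModM.+-≋ {toℕ u + toℕ v} (ModM.+-≋ {toℕ u} (rotK u u∈) (rotH v v∈)) ModM.≋-refl ⟩
              toℕ j                  ∎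
        not-in-KH ((true , u) , (true , v) , u∈ , v∈ , i⊟j≡u⊟v) = 2i≢2j (begin
              toℕ i + toℕ i          ≈⟨ ModM.+-≋ {S + toℕ j} S+j≋i ModM.≋-refl ⟨
              S + toℕ j + toℕ i      ≡⟨ solve 3 (λ s j i → s :+ j :+ i := s :+ i :+ j) refl S (toℕ j) (toℕ i) ⟩
              S + toℕ i + toℕ j      ≈⟨ ModM.+-≋ {S + toℕ i} S+i≋j ModM.≋-refl ⟩
              toℕ j + toℕ j          ∎)
          where
            open ModM.≋-Reasoning
            S+i≋j : S + toℕ i ModM.≋ toℕ j
            S+i≋j = begin
              S + toℕ i              ≈⟨ ModM.+-≋ {S} ModM.≋-refl (refH v v∈) ⟨
              S + toℕ v              ≡⟨ cong (λ z → toℕ (proj₂ z) + toℕ v) i⊟j≡u⊟v ⟩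
              toℕ (u ⊟ v) + toℕ v    ≈⟨ ≋⇒≋M (⊟-spec u v) ⟩
              toℕ u                  ≈⟨ refK u u∈ ⟩
              toℕ j                  ∎
        not-in-KH ((false , _) , (true , _) , _ , _ , ())
        not-in-KH ((true , _) , (false , _) , _ , _ , ())

module CycleObstruction where

  open import Data.Nat
  open import Data.Nat.Properties
  open import Data.Nat.DivMod
  open import Data.Nat.Divisibility
  open import Data.Fin using (Fin; toℕ; fromℕ<)
  import Data.Fin as Fin
  open import Data.Fin.Properties using (toℕ<n; toℕ-injective; toℕ-fromℕ<)
  open import Data.Bool using (Bool; true; false; not)
  open import Data.Product using (Σ; _,_; proj₁; proj₂)
  open import Data.Sum using (_⊎_; inj₁; inj₂)
  open import Data.Empty using (⊥; ⊥-elim)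
  open import Relation.Nullary using (¬_; yes; no; does)
  open import Relation.Nullary.Decidable using (dec-true)
  open import Relation.Binary.PropositionalEquality
  open import Defs
  open Congruence
  open NumberTheory
  open DivisorPairs
  open Walks
  open DihedralSubgroups

  module CycleAnalysis (n : ℕ) .{{_ : NonZero n}} (3≤n : 3 ≤ n) (hc : HamiltonianCycle n) where
    open HamiltonianCycle hc
    open Vertices n

    N : ℕ
    N = 3 + len

    subgroup : (p : Fin N) → IsSubgroup n (cyc p)
    subgroup p = proj₁ (vertices p)

    reflection : Fin N → Fin n
    reflection p = proj₁ (vertex-reflection (cyc p) (vertices p))

    reflection∈ : ∀ p → cyc p (true , reflection p) ≡ true
    reflection∈ p = proj₂ (vertex-reflection (cyc p) (vertices p))

    module S (p : Fin N) = SubgroupStructure n (cyc p) (subgroup p)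
    module R (p : Fin N) = SubgroupStructure.WithReflection n (cyc p) (subgroup p) (reflection p) (reflection∈ p)

    index : Fin N → ℕ
    index p = S.d p

    same-set⇒same-position : ∀ p q → SameSet n (cyc p) (cyc q) → p ≡ q
    same-set⇒same-position p q same with p Fin.≟ q
    ... | yes p≡q = p≡q
    ... | no  p≢q = ⊥-elim (distinct p q p≢q same)

    position : Fin n → Fin N
    position c = proj₁ (covers (reflectionGroup c) (reflectionGroup-vertex 3≤n c))

    position-same : ∀ c → SameSet n (reflectionGroup c) (cyc (position c))
    position-same c = proj₂ (covers (reflectionGroup c) (reflectionGroup-vertex 3≤n c))

    position-reflection : ∀ c → cyc (position c) (true , c) ≡ true
    position-reflection c = trans (sym (position-same c (true , c))) (dec-true (c Fin.≟ c) refl)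

    position-index : ∀ c → index (position c) ≡ n
    position-index c = S.trivial-rotations⇒d≡n (position c) λ x x∈ →
      reflectionGroup-rotation {c} x (trans (position-same c (false , x)) x∈)

    -- By the
    -- non-permuting criterion, consecutive non-special positions share their class.
    module ClassWalk (M m : ℕ) .{{_ : NonZero M}} .{{_ : NonZero m}} (m∣M : m ∣ M) (M∣n : M ∣ n)
                     (halving : ∀ {a b} → Mod._≋_ M (a + a) (b + b) → Mod._≋_ m a b) where

      special : Fin N → Bool
      special p = not (does (M ∣? index p))

      class : Fin N → ℕ
      class p = toℕ (reflection p) % m

      open CycleWalk N special class public

      ¬special⇒∣ : ∀ p → special p ≡ false → M ∣ index p
      ¬special⇒∣ p ns with M ∣? index p
      ... | yes M∣ = M∣

      special⇒∤ : ∀ p → special p ≡ true → ¬ M ∣ index p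
      special⇒∤ p s with M ∣? index p
      ... | no M∤ = M∤

      stable : ∀ p → special p ≡ false → special (next p) ≡ false → class (next p) ≡ class p
      stable p ns ns′ with class (next p) ≟ class p
      ... | yes same = same
      ... | no differ = ⊥-elim (non-permuting (cyc p) (cyc (next p)) (subgroup p) (subgroup (next p))
              (reflection p) (reflection∈ p) (reflection (next p)) (reflection∈ (next p))
              (¬special⇒∣ p ns) (¬special⇒∣ (next p) ns′) (λ 2i≋2j → differ (sym (halving 2i≋2j)))
              (adjacent p))

      ∣⇒¬special : ∀ p → M ∣ index p → special p ≡ false
      ∣⇒¬special p M∣ with M ∣? index p
      ... | yes _ = refl
      ... | no M∤ = ⊥-elim (M∤ M∣)

      position-nonspecial : ∀ c → special (position c) ≡ false
      position-nonspecial c = ∣⇒¬special (position c) (subst (M ∣_) (sym (position-index c)) M∣n)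

      position-class : ∀ c → class (position c) ≡ toℕ c % m
      position-class c = sym (weaken {{S.d≢0 (position c)}} (∣-trans m∣M (¬special⇒∣ (position c) (position-nonspecial c)))
                               (R.ref∈⇒ (position c) c (position-reflection c)))

      exit : ∀ c c′ → toℕ c′ % m ≢ toℕ c % m → Exit (toℕ c % m)
      exit c c′ differ = from-walk (walk stable (position c) (position c′) (position-nonspecial c))
        where
          from-walk : class (position c′) ≡ class (position c) ⊎ Exit (class (position c)) → Exit (toℕ c % m)
          from-walk (inj₁ same)   = ⊥-elim (differ (begin
            toℕ c′ % m             ≡⟨ position-class c′ ⟨
            class (position c′)    ≡⟨ same ⟩
            class (position c)     ≡⟨ position-class c ⟩
            toℕ c % m              ∎))
            where open ≡-Reasoning
          from-walk (inj₂ exit-c) = subst Exit (position-class c) exit-c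

    -- n = 2^a is impossible: every vertex has index divisible by 4 (indices 1 and 2
    -- give the whole group or normal subgroups), so no position is special for
    -- M = 4, while {1 , b} and {1 , ab} have different classes modulo 2.
    power-of-two-impossible : ∀ a → n ≡ 2 ^ a → ⊥
    power-of-two-impossible a n≡2^a = special⇒∤ (next q) next-special (4∣index (next q))
      where
        4∣index : ∀ p → 4 ∣ index p
        4∣index p with divisor-of-2^ a (subst (index p ∣_) n≡2^a (S.d∣n p))
        ... | inj₁ d≡1        = ⊥-elim (proj₂ (proj₁ (proj₂ (vertices p))) (R.d≡1⇒full p d≡1 _))
        ... | inj₂ (inj₁ d≡2) = ⊥-elim (proj₂ (proj₂ (vertices p)) (R.d∣2⇒normal p (subst (_∣ 2) (sym d≡2) ∣-refl)))
        ... | inj₂ (inj₂ 4∣d) = 4∣d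

        0<n : 0 < n
        0<n = ≤-trans (s≤s z≤n) 3≤n
        1<n : 1 < n
        1<n = ≤-trans (s≤s (s≤s z≤n)) 3≤n

        c₀ c₁ : Fin n
        c₀ = fromℕ< 0<n
        c₁ = fromℕ< 1<n

        open ClassWalk 4 2 (divides 2 refl) (subst (4 ∣_) (position-index c₀) (4∣index (position c₀))) (λ {a} {b} → halve₄ {a} {b})

        classes-differ : toℕ c₁ % 2 ≢ toℕ c₀ % 2
        classes-differ eq with trans (cong (_% 2) (sym (toℕ-fromℕ< 0<n))) (trans (sym eq) (cong (_% 2) (toℕ-fromℕ< 1<n)))
        ... | ()

        exit₀ : Exit (toℕ c₀ % 2)
        exit₀ = exit c₀ c₁ classes-differ

        q : Fin N
        q = proj₁ exit₀

        next-special : special (next q) ≡ true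
        next-special = proj₂ (proj₂ (proj₂ exit₀))

    -- With M = m = r every
    -- class c mod r is the class of the non-special vertex {1 , a^c b}, and some
    -- other class exists, so each class c has an exit; the special vertices just
    -- after these exits are r distinct subgroups whose index is not a multiple of r.
    -- Their invariants are r divisor pairs that σ≥2n forbids.
    odd-part-impossible : ∀ a r → n ≡ 2 ^ a * r → r % 2 ≡ 1 → 3 ≤ r → Deficient n → ⊥
    odd-part-impossible a r n≡2^ar r-odd 3≤r deficient = <⇒≱ deficient (σ≥2n {a = a} n≡2^ar invariants invariants-injective
      (λ c → S.d∣n (after c) , m%n<n (toℕ (reflection (after c))) (index (after c)) {{S.d≢0 (after c)}})
      (λ c → special⇒∤ (after c) (after-special c)))
      where
        instance
          r≢0 : NonZero r
          r≢0 = >-nonZero (≤-trans (s≤s z≤n) 3≤r)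
        r∣n : r ∣ n
        r∣n = divides (2 ^ a) n≡2^ar
        open ClassWalk r r ∣-refl r∣n (λ {x} {y} → halve {r} r-odd {x} {y})

        lift : Fin r → Fin n
        lift c = fromℕ< (≤-trans (toℕ<n c) (∣⇒≤ r∣n))
        class-lift : ∀ c → toℕ (lift c) % r ≡ toℕ c
        class-lift c = trans (cong (_% r) (toℕ-fromℕ< _)) (m<n⇒m%n≡m (toℕ<n c))
        other : ∀ {k} → 2 ≤ k → (c : Fin k) → Σ (Fin k) λ c′ → toℕ c′ ≢ toℕ c
        other {suc zero}    (s≤s ()) Fin.zero
        other {suc (suc _)} _ Fin.zero    = Fin.suc Fin.zero , λ ()
        other {suc (suc _)} _ (Fin.suc _) = Fin.zero , λ ()

        exit-of : (c : Fin r) → Exit (toℕ (lift c) % r)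
        exit-of c with other (≤-trans (s≤s (s≤s z≤n)) 3≤r) c
        ... | c′ , c′≢c = exit (lift c) (lift c′) (λ eq → c′≢c (trans (sym (class-lift c′)) (trans eq (class-lift c))))

        after : Fin r → Fin N
        after c = next (proj₁ (exit-of c))

        after-special : ∀ c → special (after c) ≡ true
        after-special c = proj₂ (proj₂ (proj₂ (exit-of c)))

        invariants : Fin r → Pair
        invariants c = index (after c) , _%_ (toℕ (reflection (after c))) (index (after c)) {{S.d≢0 (after c)}}

        -- Equal invariants give equal vertices, hence equal positions and classes.
        invariants-injective : ∀ {c c′} → invariants c ≡ invariants c′ → c ≡ c′
        invariants-injective {c} {c′} eq = toℕ-injective (begin
          toℕ c                      ≡⟨ class-lift c ⟨
          toℕ (lift c) % r           ≡⟨ proj₁ (proj₂ (proj₂ (exit-of c))) ⟨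
          class (proj₁ (exit-of c))  ≡⟨ cong class exits-equal ⟩
          class (proj₁ (exit-of c′)) ≡⟨ proj₁ (proj₂ (proj₂ (exit-of c′))) ⟩
          toℕ (lift c′) % r          ≡⟨ class-lift c′ ⟩
          toℕ c′                     ∎)
          where
            open ≡-Reasoning
            same-position : after c ≡ after c′
            same-position = same-set⇒same-position (after c) (after c′)
              (same-invariants⇒same-set (cyc (after c)) (cyc (after c′)) (subgroup (after c)) (subgroup (after c′))
                (reflection (after c)) (reflection∈ (after c)) (reflection (after c′)) (reflection∈ (after c′))
                (cong proj₁ eq) (cong proj₂ eq))
            exits-equal : proj₁ (exit-of c) ≡ proj₁ (exit-of c′)
            exits-equal = next-injective same-position

open import Defs
open import Data.Nat using (ℕ; _≥_; _≤_; _<_; _*_; _^_; >-nonZero; s≤s; z≤n)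
open import Data.Nat.Properties using (<-≤-trans; *-identityʳ)
open import Data.Sum using (_⊎_; inj₁; inj₂)
open import Data.Empty using (⊥)
open import Relation.Nullary using (¬_)
open import Relation.Binary.PropositionalEquality using (_≡_; refl; cong; trans)
open NumberTheory using (OddDecomposition; oddDecomposition; odd⇒1⊎≥3)
open CycleObstruction using (module CycleAnalysis)

theorem4p6 : (n : ℕ) → (n≥3 : n ≥ 3) → Deficient n
           → ¬ Hamiltonian n {{>-nonZero (<-≤-trans (s≤s z≤n) n≥3)}}
theorem4p6 n n≥3 deficient cycle = by-odd-part (odd⇒1⊎≥3 oddPart-odd)
  where
    0<n : 0 < n
    0<n = <-≤-trans (s≤s z≤n) n≥3
    open OddDecomposition (oddDecomposition n 0<n)
    open CycleAnalysis n {{>-nonZero 0<n}} n≥3 cycle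

    by-odd-part : oddPart ≡ 1 ⊎ 3 ≤ oddPart → ⊥
    by-odd-part (inj₁ r≡1) = power-of-two-impossible exponent
      (trans decomposition (trans (cong (2 ^ exponent *_) r≡1) (*-identityʳ _)))
    by-odd-part (inj₂ 3≤r) = odd-part-impossible exponent oddPart decomposition oddPart-odd 3≤r deficient
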